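{- Let $\mathbf{C}$ be a concrete category (so objects have underlying sets of elements) with a terminal object $1$, let $G:\mathbf{C}\to\mathbf{C}$ be a functor, $(M,\eta,\mu)$ a monad on $\mathbf{C}$, and $\alpha:G\to M$ a natural transformation. Let $\gamma:X\to GX$ be a $G$-coalgebra and $x,x'\in X$ states that are finite-depth behaviourally equivalent, i.e. $\gamma_n(x)=\gamma_n(x')$ for all $n<\omega$. Then $x$ and $x'$ are $\alpha$-trace equivalent, i.e. $(M!_X\circ\gamma^{(n)})(x)=(M!_X\circ\gamma^{(n)})(x')$ for all $n<\omega$.
   Context: $!_X:X\to1$ is the unique morphism. For $f:X\to MY$, $f^*=\mu_Y\circ Mf$. The iterations $\gamma^{(n)}:X\to MX$ are defined by $\gamma^{(0)}=\eta_X$, $\gamma^{(n+1)}=(\alpha_X\circ\gamma)^*\circ\gamma^{(n)}$. The canonical cone $\gamma_n:X\to G^n1$ is defined by $\gamma_0=!_X$ and $\gamma_{n+1}=G(\gamma_n)\circ\gamma$. The $\alpha$-trace sequence of $x$ is $(M!_X\circ\gamma^{(n)}(x))_{n<\omega}$, and two states are $\alpha$-trace equivalent if their $\alpha$-trace sequences are equal. -}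

module Defs where

open import Level using (Level; _⊔_) renaming (suc to lsuc)
open import Data.Nat using (ℕ; zero; suc)
open import Relation.Binary.PropositionalEquality using (_≡_)

-- Objects X have underlying sets U X, morphisms act on elements via
-- ⟦_⟧, and (faithfulness) two morphisms are equal iff their underlying
-- functions agree pointwise; morphism equality is therefore _≈_ below.
record ConcreteCategory (o h e : Level) : Set (lsuc (o ⊔ h ⊔ e)) where
  infixr 9 _∘_
  infix 4 _≈_
  field
    Obj  : Set o
    Hom  : Obj → Obj → Set h
    U    : Obj → Set e
    ⟦_⟧  : ∀ {A B} → Hom A B → U A → U B
    id   : ∀ {A} → Hom A A
    _∘_  : ∀ {A B C} → Hom B C → Hom A B → Hom A C
    ⟦id⟧ : ∀ {A} (x : U A) → ⟦ id {A} ⟧ x ≡ x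
    ⟦∘⟧  : ∀ {A B C} (g : Hom B C) (f : Hom A B) (x : U A) →
           ⟦ g ∘ f ⟧ x ≡ ⟦ g ⟧ (⟦ f ⟧ x)

  _≈_ : ∀ {A B} → Hom A B → Hom A B → Set e
  f ≈ g = ∀ x → ⟦ f ⟧ x ≡ ⟦ g ⟧ x

module _ {o h e : Level} (C : ConcreteCategory o h e) where
  open ConcreteCategory C

  record Terminal : Set (o ⊔ h ⊔ e) where
    field
      𝟙       : Obj
      !       : ∀ {A} → Hom A 𝟙
      !-unique : ∀ {A} (f : Hom A 𝟙) → f ≈ !

  record Endofunctor : Set (o ⊔ h ⊔ e) where
    field
      F₀     : Obj → Obj
      F₁     : ∀ {A B} → Hom A B → Hom (F₀ A) (F₀ B)
      F-id   : ∀ {A} → F₁ (id {A}) ≈ id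
      F-∘    : ∀ {A B C} (g : Hom B C) (f : Hom A B) → F₁ (g ∘ f) ≈ F₁ g ∘ F₁ f
      F-resp : ∀ {A B} {f g : Hom A B} → f ≈ g → F₁ f ≈ F₁ g

  record NatTrans (F G : Endofunctor) : Set (o ⊔ h ⊔ e) where
    private
      module F = Endofunctor F
      module G = Endofunctor G
    field
      η       : ∀ X → Hom (F.F₀ X) (G.F₀ X)
      natural : ∀ {A B} (f : Hom A B) → η B ∘ F.F₁ f ≈ G.F₁ f ∘ η A

  record Monad : Set (o ⊔ h ⊔ e) where
    field
      functor : Endofunctor
    open Endofunctor functor public renaming (F₀ to M₀; F₁ to M₁)
    field
      η      : ∀ X → Hom X (M₀ X)
      μ      : ∀ X → Hom (M₀ (M₀ X)) (M₀ X)
      η-natural : ∀ {A B} (f : Hom A B) → η B ∘ f ≈ M₁ f ∘ η A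
      μ-natural : ∀ {A B} (f : Hom A B) → μ B ∘ M₁ (M₁ f) ≈ M₁ f ∘ μ A
      identityˡ : ∀ {X} → μ X ∘ M₁ (η X) ≈ id
      identityʳ : ∀ {X} → μ X ∘ η (M₀ X) ≈ id
      assoc     : ∀ {X} → μ X ∘ M₁ (μ X) ≈ μ X ∘ μ (M₀ X)

module Coalg {o h e : Level} (C : ConcreteCategory o h e) (T : Terminal C)
             (G : Endofunctor C) (M : Monad C) (α : NatTrans C G (Monad.functor M))
             {X : ConcreteCategory.Obj C}
             (γ : ConcreteCategory.Hom C X (Endofunctor.F₀ G X)) where
  open ConcreteCategory C
  open Terminal T
  open Endofunctor G
  open Monad M hiding (η)
  open NatTrans α renaming (η to αₓ)

  _* : ∀ {A B} → Hom A (M₀ B) → Hom (M₀ A) (M₀ B)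
  _* {B = B} f = μ B ∘ M₁ f

  iter : ℕ → Hom X (M₀ X)
  iter zero    = Monad.η M X
  iter (suc n) = ((αₓ X ∘ γ) *) ∘ iter n

  Gpow : ℕ → Obj
  Gpow zero    = 𝟙
  Gpow (suc n) = F₀ (Gpow n)

  cone : (n : ℕ) → Hom X (Gpow n)
  cone zero    = !
  cone (suc n) = F₁ (cone n) ∘ γ

  traceSeq : ℕ → U X → U (M₀ 𝟙)
  traceSeq n x = ⟦ M₁ (! {X}) ∘ iter n ⟧ x

-- The n-th trace M!_X ∘ γ^(n) factors through the n-th cone map γ_n : X → G^n 1
-- via a map τ_n : G^n 1 → M 1 that does not depend on γ (τ_0 = η_1,
-- τ_{n+1} = τ_n* ∘ α_{G^n 1}).  The induction step rests on the identity
-- γ^(n+1) = (γ^(n))* ∘ α_X ∘ γ, i.e. on unfolding the iteration from the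
-- other end, which holds by associativity of Kleisli composition.  States
-- identified by every γ_n therefore have equal trace sequences.
module Submission where

open import Defs
open import Level using (Level)
open import Data.Nat using (ℕ; zero; suc)
open import Function using (_∘′_)
open import Relation.Binary.PropositionalEquality
  using (_≡_; sym; trans; cong; module ≡-Reasoning)

module ConcreteReasoning {o h e : Level} (C : ConcreteCategory o h e) where
  open ConcreteCategory C

  ∘-≈⇒pointwise : ∀ {A B B′ D} {g : Hom B D} {f : Hom A B} {g′ : Hom B′ D} {f′ : Hom A B′} →
                  g ∘ f ≈ g′ ∘ f′ → ∀ x → ⟦ g ⟧ (⟦ f ⟧ x) ≡ ⟦ g′ ⟧ (⟦ f′ ⟧ x)
  ∘-≈⇒pointwise {g = g} {f} {g′} {f′} p x =
    trans (sym (⟦∘⟧ g f x)) (trans (p x) (⟦∘⟧ g′ f′ x))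

  ∘-assoc : ∀ {A B D E} (h : Hom D E) (g : Hom B D) (f : Hom A B) →
            (h ∘ g) ∘ f ≈ h ∘ (g ∘ f)
  ∘-assoc h g f x = begin
    ⟦ (h ∘ g) ∘ f ⟧ x       ≡⟨ trans (⟦∘⟧ _ _ x) (⟦∘⟧ _ _ _) ⟩
    ⟦ h ⟧ (⟦ g ⟧ (⟦ f ⟧ x)) ≡⟨ trans (⟦∘⟧ _ _ x) (cong ⟦ h ⟧ (⟦∘⟧ _ _ x)) ⟨
    ⟦ h ∘ (g ∘ f) ⟧ x       ∎
    where open ≡-Reasoning

  ∘-≈-id⇒pointwise : ∀ {A B} {g : Hom B A} {f : Hom A B} →
                     g ∘ f ≈ id → ∀ x → ⟦ g ⟧ (⟦ f ⟧ x) ≡ x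
  ∘-≈-id⇒pointwise {g = g} {f} p x = trans (sym (⟦∘⟧ g f x)) (trans (p x) (⟦id⟧ x))

module Kleisli {o h e : Level} (C : ConcreteCategory o h e) (M : Monad C) where
  open ConcreteCategory C
  open Monad M
  open ConcreteReasoning C
  open ≡-Reasoning

  -- Definitionally the Kleisli extension of Defs, which is only available
  -- together with a coalgebra.
  infix 10 _*
  _* : ∀ {A B} → Hom A (M₀ B) → Hom (M₀ A) (M₀ B)
  _* {B = B} f = μ B ∘ M₁ f

  M₁-⟦∘⟧ : ∀ {A B D} (g : Hom B D) (f : Hom A B) m →
           ⟦ M₁ (g ∘ f) ⟧ m ≡ ⟦ M₁ g ⟧ (⟦ M₁ f ⟧ m)
  M₁-⟦∘⟧ g f m = trans (F-∘ g f m) (⟦∘⟧ (M₁ g) (M₁ f) m)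

  *-resp-≈ : ∀ {A B} {f g : Hom A (M₀ B)} → f ≈ g → f * ≈ g *
  *-resp-≈ {B = B} p m = trans (⟦∘⟧ _ _ m) (trans (cong ⟦ μ B ⟧ (F-resp p m)) (sym (⟦∘⟧ _ _ m)))

  *-identityʳ : ∀ {A B} (f : Hom A (M₀ B)) → f * ∘ η A ≈ f
  *-identityʳ {A} {B} f x = begin
    ⟦ f * ∘ η A ⟧ x                   ≡⟨ trans (⟦∘⟧ _ _ x) (⟦∘⟧ _ _ _) ⟩
    ⟦ μ B ⟧ (⟦ M₁ f ⟧ (⟦ η A ⟧ x))    ≡⟨ cong ⟦ μ B ⟧ (∘-≈⇒pointwise (η-natural f) x) ⟨
    ⟦ μ B ⟧ (⟦ η (M₀ B) ⟧ (⟦ f ⟧ x))  ≡⟨ ∘-≈-id⇒pointwise identityʳ (⟦ f ⟧ x) ⟩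
    ⟦ f ⟧ x                           ∎

  *-identityˡ : ∀ {A} → η A * ≈ id
  *-identityˡ = identityˡ

  *-∘-M₁ : ∀ {A B D} (g : Hom B (M₀ D)) (f : Hom A B) → (g ∘ f) * ≈ g * ∘ M₁ f
  *-∘-M₁ {D = D} g f m = begin
    ⟦ μ D ∘ M₁ (g ∘ f) ⟧ m             ≡⟨ ⟦∘⟧ _ _ m ⟩
    ⟦ μ D ⟧ (⟦ M₁ (g ∘ f) ⟧ m)         ≡⟨ cong ⟦ μ D ⟧ (M₁-⟦∘⟧ g f m) ⟩
    ⟦ μ D ⟧ (⟦ M₁ g ⟧ (⟦ M₁ f ⟧ m))    ≡⟨ trans (sym (⟦∘⟧ _ _ _)) (sym (⟦∘⟧ _ _ m)) ⟩
    ⟦ g * ∘ M₁ f ⟧ m                   ∎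

  M₁-∘-* : ∀ {A B D} (g : Hom B D) (f : Hom A (M₀ B)) → M₁ g ∘ f * ≈ (M₁ g ∘ f) *
  M₁-∘-* {B = B} {D} g f m = begin
    ⟦ M₁ g ∘ f * ⟧ m                        ≡⟨ trans (⟦∘⟧ _ _ m) (cong ⟦ M₁ g ⟧ (⟦∘⟧ _ _ m)) ⟩
    ⟦ M₁ g ⟧ (⟦ μ B ⟧ (⟦ M₁ f ⟧ m))         ≡⟨ ∘-≈⇒pointwise (μ-natural g) _ ⟨
    ⟦ μ D ⟧ (⟦ M₁ (M₁ g) ⟧ (⟦ M₁ f ⟧ m))    ≡⟨ trans (⟦∘⟧ _ _ m) (cong ⟦ μ D ⟧ (M₁-⟦∘⟧ (M₁ g) f m)) ⟨
    ⟦ (M₁ g ∘ f) * ⟧ m                      ∎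

  *-assoc : ∀ {A B D} (g : Hom B (M₀ D)) (f : Hom A (M₀ B)) → g * ∘ f * ≈ (g * ∘ f) *
  *-assoc {B = B} {D} g f m = begin
      ⟦ g * ∘ f * ⟧ m
    ≡⟨ trans (∘-assoc (μ D) (M₁ g) (f *) m) (⟦∘⟧ _ _ m) ⟩
      ⟦ μ D ⟧ (⟦ M₁ g ∘ f * ⟧ m)
    ≡⟨ cong ⟦ μ D ⟧ (trans (M₁-∘-* g f m) (⟦∘⟧ _ _ m)) ⟩
      ⟦ μ D ⟧ (⟦ μ (M₀ D) ⟧ (⟦ M₁ (M₁ g ∘ f) ⟧ m))
    ≡⟨ ∘-≈⇒pointwise assoc _ ⟨
      ⟦ μ D ⟧ (⟦ M₁ (μ D) ⟧ (⟦ M₁ (M₁ g ∘ f) ⟧ m))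
    ≡⟨ cong ⟦ μ D ⟧ (M₁-⟦∘⟧ (μ D) (M₁ g ∘ f) m) ⟨
      ⟦ μ D ⟧ (⟦ M₁ (μ D ∘ (M₁ g ∘ f)) ⟧ m)
    ≡⟨ cong ⟦ μ D ⟧ (F-resp (λ y → sym (∘-assoc (μ D) (M₁ g) f y)) m) ⟩
      ⟦ μ D ⟧ (⟦ M₁ (g * ∘ f) ⟧ m)
    ≡⟨ ⟦∘⟧ _ _ m ⟨
      ⟦ (g * ∘ f) * ⟧ m
    ∎

module CoalgebraTrace {o h e : Level} (C : ConcreteCategory o h e) (T : Terminal C)
                      (G : Endofunctor C) (M : Monad C) (α : NatTrans C G (Monad.functor M))
                      {X : ConcreteCategory.Obj C}
                      (γ : ConcreteCategory.Hom C X (Endofunctor.F₀ G X)) where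
  open ConcreteCategory C
  open Terminal T
  open Endofunctor G
  open Monad M
  open NatTrans α renaming (η to αₓ)
  open Coalg C T G M α γ hiding (_*)
  open Kleisli C M
  open ConcreteReasoning C
  open ≡-Reasoning

  αγ : Hom X (M₀ X)
  αγ = αₓ X ∘ γ

  iter-suc-unfoldʳ : ∀ n → iter (suc n) ≈ iter n * ∘ αγ
  iter-suc-unfoldʳ zero x = begin
    ⟦ αγ * ∘ η X ⟧ x     ≡⟨ *-identityʳ αγ x ⟩
    ⟦ αγ ⟧ x             ≡⟨ trans (*-identityˡ _) (⟦id⟧ _) ⟨
    ⟦ η X * ⟧ (⟦ αγ ⟧ x) ≡⟨ ⟦∘⟧ _ _ x ⟨
    ⟦ η X * ∘ αγ ⟧ x     ∎
  iter-suc-unfoldʳ (suc n) x = begin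
    ⟦ αγ * ∘ iter (suc n) ⟧ x          ≡⟨ ⟦∘⟧ _ _ x ⟩
    ⟦ αγ * ⟧ (⟦ iter (suc n) ⟧ x)      ≡⟨ cong ⟦ αγ * ⟧ (trans (iter-suc-unfoldʳ n x) (⟦∘⟧ _ _ x)) ⟩
    ⟦ αγ * ⟧ (⟦ iter n * ⟧ (⟦ αγ ⟧ x)) ≡⟨ trans (sym (⟦∘⟧ _ _ _)) (*-assoc αγ (iter n) _) ⟩
    ⟦ iter (suc n) * ⟧ (⟦ αγ ⟧ x)      ≡⟨ ⟦∘⟧ _ _ x ⟨
    ⟦ iter (suc n) * ∘ αγ ⟧ x          ∎

  coneTrace : ∀ n → Hom (Gpow n) (M₀ 𝟙)
  coneTrace zero    = η 𝟙
  coneTrace (suc n) = coneTrace n * ∘ αₓ (Gpow n)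

  trace-factors-through-cone : ∀ n → M₁ ! ∘ iter n ≈ coneTrace n ∘ cone n
  trace-factors-through-cone zero x = sym (η-natural ! x)
  trace-factors-through-cone (suc n) x = begin
      ⟦ M₁ ! ∘ iter (suc n) ⟧ x
    ≡⟨ trans (⟦∘⟧ _ _ x) (cong ⟦ M₁ ! ⟧ (trans (iter-suc-unfoldʳ n x) (⟦∘⟧ _ _ x))) ⟩
      ⟦ M₁ ! ⟧ (⟦ iter n * ⟧ (⟦ αγ ⟧ x))
    ≡⟨ trans (sym (⟦∘⟧ _ _ _)) (M₁-∘-* ! (iter n) _) ⟩
      ⟦ (M₁ ! ∘ iter n) * ⟧ (⟦ αγ ⟧ x)
    ≡⟨ *-resp-≈ (trace-factors-through-cone n) _ ⟩
      ⟦ (coneTrace n ∘ cone n) * ⟧ (⟦ αγ ⟧ x)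
    ≡⟨ trans (*-∘-M₁ (coneTrace n) (cone n) _) (⟦∘⟧ _ _ _) ⟩
      ⟦ coneTrace n * ⟧ (⟦ M₁ (cone n) ⟧ (⟦ αₓ X ∘ γ ⟧ x))
    ≡⟨ cong (⟦ coneTrace n * ⟧ ∘′ ⟦ M₁ (cone n) ⟧) (⟦∘⟧ _ _ x) ⟩
      ⟦ coneTrace n * ⟧ (⟦ M₁ (cone n) ⟧ (⟦ αₓ X ⟧ (⟦ γ ⟧ x)))
    ≡⟨ cong ⟦ coneTrace n * ⟧ (∘-≈⇒pointwise (natural (cone n)) _) ⟨
      ⟦ coneTrace n * ⟧ (⟦ αₓ (Gpow n) ⟧ (⟦ F₁ (cone n) ⟧ (⟦ γ ⟧ x)))
    ≡⟨ trans (⟦∘⟧ _ _ x) (trans (⟦∘⟧ _ _ _) (cong (⟦ coneTrace n * ⟧ ∘′ ⟦ αₓ (Gpow n) ⟧) (⟦∘⟧ _ _ x))) ⟨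
      ⟦ coneTrace (suc n) ∘ cone (suc n) ⟧ x
    ∎

corollary3 : ∀ {o h e : Level} (C : ConcreteCategory o h e) (T : Terminal C)
               (G : Endofunctor C) (M : Monad C) (α : NatTrans C G (Monad.functor M))
               {X : ConcreteCategory.Obj C}
               (γ : ConcreteCategory.Hom C X (Endofunctor.F₀ G X))
               (x x′ : ConcreteCategory.U C X) →
               (∀ (n : ℕ) → ConcreteCategory.⟦_⟧ C (Coalg.cone C T G M α γ n) x
                            ≡ ConcreteCategory.⟦_⟧ C (Coalg.cone C T G M α γ n) x′) →
               ∀ (n : ℕ) → Coalg.traceSeq C T G M α γ n x ≡ Coalg.traceSeq C T G M α γ n x′
corollary3 C T G M α γ x x′ same-cone n = begin
  traceSeq n x                   ≡⟨ trace-factors-through-cone n x ⟩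
  ⟦ coneTrace n ∘ cone n ⟧ x      ≡⟨ ⟦∘⟧ _ _ x ⟩
  ⟦ coneTrace n ⟧ (⟦ cone n ⟧ x)  ≡⟨ cong ⟦ coneTrace n ⟧ (same-cone n) ⟩
  ⟦ coneTrace n ⟧ (⟦ cone n ⟧ x′) ≡⟨ ⟦∘⟧ _ _ x′ ⟨
  ⟦ coneTrace n ∘ cone n ⟧ x′     ≡⟨ trace-factors-through-cone n x′ ⟨
  traceSeq n x′                  ∎
  where
  open ConcreteCategory C
  open Coalg C T G M α γ
  open CoalgebraTrace C T G M α γ
  open ≡-Reasoning
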